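{- A bridgeless graph $G$ is $2$-simultaneous edge colorable if and only if $G$ has a cycle double cover $\mathcal{C}$ with the following properties: (i) every circuit of $\mathcal{C}$ is an even circuit (has even length); (ii) $\mathcal{C}$ can be partitioned into at least $\chi'(G)$ classes such that the union of the circuits in each class is a $2$-regular subgraph; (iii) every circuit in $\mathcal{C}$ has a proper $2$-edge coloring (with colors $1,2$) such that each edge $e\in E(G)$ receives different colors in the two circuits of $\mathcal{C}$ containing it.
   Context: All graphs are finite and simple; $[l]=\{1,\ldots,l\}$. "Bridgeless" means $2$-edge-connected. A circuit is a connected $2$-regular subgraph. Here a cycle double cover of $G$ is a collection (multiset) of circuits of $G$ such that every edge of $G$ lies in exactly two members of the collection. $\chi'(G)$ is the edge chromatic number. A $2$-simultaneous edge coloring of $G$ is a pair $(c_1,c_2)$ of proper edge colorings $c_i:E(G)\to[l]$ with a common color set such that for every vertex $v$ the sets of colors on edges incident to $v$ are the same under $c_1$ and $c_2$, and $c_1(e)\ne c_2(e)$ for every edge $e$; $G$ is $2$-simultaneous edge colorable if such a pair exists for some $l$. -}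

module Defs where

open import Data.Nat using (ℕ; zero; suc; _+_; _*_; _≤_)
open import Data.Nat.Divisibility using (_∣_)
open import Data.Fin using (Fin; zero; suc; _≟_)
open import Data.Bool using (Bool; true; false; _∧_; _∨_; not; if_then_else_; T)
open import Data.Product using (Σ; ∃; ∃-syntax; _×_; _,_)
open import Data.Sum using (_⊎_)
open import Function using (_∘_; _⇔_)
open import Relation.Nullary using (¬_)
open import Relation.Nullary.Decidable using (⌊_⌋)
open import Relation.Binary.PropositionalEquality using (_≡_; _≢_)

record Graph : Set where
  field
    n m    : ℕ
    src tgt : Fin m → Fin n
    loopless : ∀ e → src e ≢ tgt e
    simple : ∀ e f →
      ((src e ≡ src f × tgt e ≡ tgt f) ⊎ (src e ≡ tgt f × tgt e ≡ src f)) → e ≡ f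

open Graph public

count : ∀ {k} → (Fin k → Bool) → ℕ
count {zero}  p = 0
count {suc k} p = (if p zero then 1 else 0) + count (p ∘ suc)

anyFin : ∀ {k} → (Fin k → Bool) → Bool
anyFin {zero}  p = false
anyFin {suc k} p = p zero ∨ anyFin (p ∘ suc)

module _ (G : Graph) where

  incB : Fin (n G) → Fin (m G) → Bool
  incB v e = ⌊ v ≟ src G e ⌋ ∨ ⌊ v ≟ tgt G e ⌋

  Inc : Fin (n G) → Fin (m G) → Set
  Inc v e = v ≡ src G e ⊎ v ≡ tgt G e

  Adjacent : Fin (m G) → Fin (m G) → Set
  Adjacent e f = e ≢ f × ∃[ v ] (Inc v e × Inc v f)

  -- a (spanning-vertex) subgraph given by its edge set
  EdgeSet : Set
  EdgeSet = Fin (m G) → Bool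

  allEdges : EdgeSet
  allEdges _ = true

  deleteEdge : Fin (m G) → EdgeSet
  deleteEdge e f = not ⌊ f ≟ e ⌋

  deg : EdgeSet → Fin (n G) → ℕ
  deg S v = count (λ e → S e ∧ incB v e)

  data Walk (S : EdgeSet) : Fin (n G) → Fin (n G) → Set where
    here : ∀ {u} → Walk S u u
    step : ∀ {u w v} (e : Fin (m G)) → T (S e) →
           ((u ≡ src G e × w ≡ tgt G e) ⊎ (u ≡ tgt G e × w ≡ src G e)) →
           Walk S w v → Walk S u v

  Connected : Set
  Connected = ∀ u v → Walk allEdges u v

  Bridgeless : Set
  Bridgeless = Connected × (∀ e u v → Walk (deleteEdge e) u v)

  InSub : EdgeSet → Fin (n G) → Set
  InSub S v = ∃[ e ] (T (S e) × Inc v e)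

  -- 2-regular subgraph (the subgraph formed by the edges of S, with the
  -- vertices they cover): every vertex has degree 0 or 2 in S
  TwoRegular : EdgeSet → Set
  TwoRegular S = ∀ v → deg S v ≡ 0 ⊎ deg S v ≡ 2

  Circuit : EdgeSet → Set
  Circuit S = (∃[ e ] T (S e)) × TwoRegular S
            × (∀ u v → InSub S u → InSub S v → Walk S u v)

  -- cycle double cover: a family (multiset) of N circuits such that every
  -- edge lies in exactly two of them
  IsCDC : (N : ℕ) → (Fin N → EdgeSet) → Set
  IsCDC N C = (∀ i → Circuit (C i)) × (∀ e → count (λ i → C i e) ≡ 2)

  ProperColoring : (k : ℕ) → (Fin (m G) → Fin k) → Set
  ProperColoring k c = ∀ e f → Adjacent e f → c e ≢ c f

  EdgeColorable : ℕ → Set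
  EdgeColorable k = ∃[ c ] ProperColoring k c

  IsChromaticIndex : ℕ → Set
  IsChromaticIndex k = EdgeColorable k × (∀ j → EdgeColorable j → k ≤ j)

  SimultaneousColoring : (l : ℕ) → (Fin (m G) → Fin l) → (Fin (m G) → Fin l) → Set
  SimultaneousColoring l c₁ c₂ =
    ProperColoring l c₁ × ProperColoring l c₂
    × (∀ v (a : Fin l) → (∃[ e ] (Inc v e × c₁ e ≡ a)) ⇔ (∃[ e ] (Inc v e × c₂ e ≡ a)))
    × (∀ e → c₁ e ≢ c₂ e)

  TwoSimultaneousColorable : Set
  TwoSimultaneousColorable = ∃[ l ] ∃[ c₁ ] ∃[ c₂ ] SimultaneousColoring l c₁ c₂

  classUnion : ∀ {N l} → (Fin N → EdgeSet) → (Fin N → Fin l) → Fin l → EdgeSet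
  classUnion C p j e = anyFin (λ i → ⌊ p i ≟ j ⌋ ∧ C i e)

  AllEven : ∀ {N} → (Fin N → EdgeSet) → Set
  AllEven {N} C = ∀ i → 2 ∣ count (C i)

  GoodPartition : ∀ {N} → (Fin N → EdgeSet) → Set
  GoodPartition {N} C =
    ∃[ l ] ∃[ p ] ((∀ k → IsChromaticIndex k → k ≤ l)
                   × (∀ (j : Fin l) → ∃[ i ] p i ≡ j)
                   × (∀ j → TwoRegular (classUnion {N} {l} C p j)))

  GoodTwoColoring : ∀ {N} → (Fin N → EdgeSet) → Set
  GoodTwoColoring {N} C =
    Σ (Fin N → Fin (m G) → Fin 2) λ d → ((∀ (i : Fin N) e f → T (C i e) → T (C i f) → Adjacent e f → d i e ≢ d i f)
            × (∀ (i i' : Fin N) e → i ≢ i' → T (C i e) → T (C i' e) → d i e ≢ d i' e))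
    -- d i : the 2-coloring of circuit i (only values on its edges matter)

-- Given a 2-simultaneous colouring (c₁, c₂), the edges to which c₁ or c₂ gives the colour a form a
-- 2-regular subgraph: at each vertex exactly one edge of each kind or none, by properness and the
-- equality of the colour sets. Its components are circuits, even because by the handshake lemma both
-- kinds of edges are equally many, and properly 2-coloured by the kind. Every edge lies on exactly
-- the two circuits of colours c₁ e ≠ c₂ e, and the singleton partition works because sending e to
-- its circuit of colour c₁ e is a proper edge colouring. Conversely the circuits of the cover serve
-- as colours: c_b e is the circuit through e on which e has side b. Both colourings are proper since
-- sides alternate along a circuit, and a circuit through v carries one edge at v of each side, so
-- the colour sets at v agree.

module Submission where

open import Defs
open import Data.Bool using (Bool; true; false; _∧_; _∨_; _xor_; if_then_else_; T; T?)
open import Data.Bool.Properties using (T-∧; T-∨; ∧-distribʳ-∨)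
open import Data.Empty using (⊥-elim)
open import Data.Fin using (Fin; zero; suc; _≟_; _<_)
open import Data.Fin.Properties using (suc-injective; any?; all?; _<?_; <-cmp)
open import Data.Nat.Divisibility using (_∣_; divides)
open import Data.Nat using (ℕ; zero; suc; pred; _+_; _*_; _≤_; z≤n; s≤s)
open import Data.Nat.Properties using (+-0-commutativeMonoid; n≤1+n; ≤-trans; n≤1⇒n≡0∨n≡1; +-suc; +-comm; 1+n≰n; +-identityʳ; *-comm; *-cancelˡ-≡)
open import Algebra.Properties.CommutativeMonoid.Sum +-0-commutativeMonoid
  using (sum-syntax; ∑-comm; ∑-distrib-+; sum-cong-≗; sum-replicate-zero)
open import Data.Product using (Σ; ∃-syntax; _×_; _,_; proj₁; proj₂)
open import Data.Sum using (_⊎_; inj₁; inj₂)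
import Data.Sum as Sum
import Data.Product as Product
open import Function using (_∘_; id; _⇔_; Equivalence)
open Equivalence using (to; from)
open import Function.Bundles using (mk⇔)
open import Relation.Nullary using (¬_; Dec; yes; no)
open import Relation.Nullary.Decidable using (⌊_⌋; toWitness; fromWitness; _→-dec_; ¬?)
open import Relation.Binary.Definitions using (tri<; tri≈; tri>)
open import Relation.Binary.PropositionalEquality using (_≡_; _≢_; refl; sym; trans; cong; cong₂; subst; module ≡-Reasoning)

T-ext : ∀ {a b} → (T a → T b) → (T b → T a) → a ≡ b
T-ext {false} {false} _ _ = refl
T-ext {false} {true}  _ b⇒a = ⊥-elim (b⇒a _)
T-ext {true}  {false} a⇒b _ = ⊥-elim (a⇒b _)
T-ext {true}  {true}  _ _ = refl

bit : Bool → Fin 2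
bit true  = zero
bit false = suc zero

bit-injective : ∀ {a b} → bit a ≡ bit b → a ≡ b
bit-injective {true}  {true}  _ = refl
bit-injective {false} {false} _ = refl

Fin2-covered : ∀ {x y : Fin 2} → x ≢ y → ∀ z → z ≡ x ⊎ z ≡ y
Fin2-covered {zero}     {zero}     x≢y _          = ⊥-elim (x≢y refl)
Fin2-covered {suc zero} {suc zero} x≢y _          = ⊥-elim (x≢y refl)
Fin2-covered {zero}     {suc zero} _   zero       = inj₁ refl
Fin2-covered {zero}     {suc zero} _   (suc zero) = inj₂ refl
Fin2-covered {suc zero} {zero}     _   zero       = inj₂ refl
Fin2-covered {suc zero} {zero}     _   (suc zero) = inj₁ refl

T-anyFin : ∀ {k} {p : Fin k → Bool} → T (anyFin p) ⇔ (∃[ i ] T (p i))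
T-anyFin {zero}      = mk⇔ (λ ()) (λ ())
T-anyFin {suc k} {p} = mk⇔ to′ from′
  where
  to′ : T (anyFin p) → ∃[ i ] T (p i)
  to′ any with to (T-∨ {p zero}) any
  ... | inj₁ p0   = zero , p0
  ... | inj₂ rest = let i , pi = to T-anyFin rest in suc i , pi
  from′ : ∃[ i ] T (p i) → T (anyFin p)
  from′ (zero  , p0) = from (T-∨ {p zero}) (inj₁ p0)
  from′ (suc i , pi) = from (T-∨ {p zero}) (inj₂ (from T-anyFin (i , pi)))

count-cong : ∀ {k} {p q : Fin k → Bool} → (∀ i → p i ≡ q i) → count p ≡ count q
count-cong {zero}  p≗q = refl
count-cong {suc k} p≗q = cong₂ _+_ (cong (λ b → if b then 1 else 0) (p≗q zero)) (count-cong (p≗q ∘ suc))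

count≡∑ : ∀ {k} (p : Fin k → Bool) → count p ≡ ∑[ i < k ] (if p i then 1 else 0)
count≡∑ {zero}  p = refl
count≡∑ {suc k} p = cong ((if p zero then 1 else 0) +_) (count≡∑ (p ∘ suc))

count≤ : ∀ {k} (p : Fin k → Bool) → count p ≤ k
count≤ {zero}  p = z≤n
count≤ {suc k} p with p zero
... | true  = s≤s (count≤ (p ∘ suc))
... | false = ≤-trans (count≤ (p ∘ suc)) (n≤1+n k)

count≡0 : ∀ {k} (p : Fin k → Bool) → (∀ i → ¬ T (p i)) → count p ≡ 0
count≡0 {zero}  p ¬p = refl
count≡0 {suc k} p ¬p with p zero in eq
... | true  = ⊥-elim (¬p zero (subst T (sym eq) _))
... | false = count≡0 (p ∘ suc) (¬p ∘ suc)

count≡0⇒¬T : ∀ {k} (p : Fin k → Bool) → count p ≡ 0 → ∀ i → ¬ T (p i)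
count≡0⇒¬T {suc k} p none i pi with p zero in eq
count≡0⇒¬T {suc k} p ()   _       _  | true
count≡0⇒¬T {suc k} p none zero    p0 | false = subst T eq p0
count≡0⇒¬T {suc k} p none (suc i) pi | false = count≡0⇒¬T (p ∘ suc) none i pi

count-suc⇒∃ : ∀ {k j} (p : Fin k → Bool) → count p ≡ suc j → ∃[ i ] T (p i)
count-suc⇒∃ {zero} p ()
count-suc⇒∃ {suc k} p count≡ with p zero in eq
... | true  = zero , subst T (sym eq) _
... | false = let i , pi = count-suc⇒∃ (p ∘ suc) count≡ in suc i , pi

count≤1 : ∀ {k} (p : Fin k → Bool) → (∀ i j → T (p i) → T (p j) → i ≡ j) → count p ≤ 1
count≤1 {zero}  p unique = z≤n
count≤1 {suc k} p unique with p zero in eq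
... | true  = s≤s (subst (_≤ 0) (sym (count≡0 (p ∘ suc) zero≢suc)) z≤n)
  where
  zero≢suc : ∀ i → ¬ T (p (suc i))
  zero≢suc i psi with unique zero (suc i) (subst T (sym eq) _) psi
  ... | ()
... | false = count≤1 (p ∘ suc) (λ i j pi pj → suc-injective (unique (suc i) (suc j) pi pj))

count≡1 : ∀ {k} (p : Fin k → Bool) {i} → T (p i) → (∀ j → T (p j) → j ≡ i) → count p ≡ 1
count≡1 p {i} pi unique with n≤1⇒n≡0∨n≡1 (count≤1 p (λ j j′ pj pj′ → trans (unique j pj) (sym (unique j′ pj′))))
... | inj₁ none = ⊥-elim (count≡0⇒¬T p none i pi)
... | inj₂ one  = one

count-≟ : ∀ {k} (j : Fin k) → count (λ i → ⌊ i ≟ j ⌋) ≡ 1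
count-≟ j = count≡1 (λ i → ⌊ i ≟ j ⌋) (fromWitness refl) (λ i → toWitness)

count-∨ : ∀ {k} (p q : Fin k → Bool) → (∀ i → T (p i) → ¬ T (q i)) →
          count (λ i → p i ∨ q i) ≡ count p + count q
count-∨ {zero}  p q disjoint = refl
count-∨ {suc k} p q disjoint with p zero in eqp | q zero in eqq
... | true  | true  = ⊥-elim (disjoint zero (subst T (sym eqp) _) (subst T (sym eqq) _))
... | true  | false = cong suc (count-∨ (p ∘ suc) (q ∘ suc) (disjoint ∘ suc))
... | false | true  = trans (cong suc (count-∨ (p ∘ suc) (q ∘ suc) (disjoint ∘ suc)))
                           (sym (+-suc (count (p ∘ suc)) (count (q ∘ suc))))
... | false | false = count-∨ (p ∘ suc) (q ∘ suc) (disjoint ∘ suc)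

count≡2 : ∀ {k} (p : Fin k → Bool) {i j} → i ≢ j → T (p i) → T (p j) →
          (∀ x → T (p x) → x ≡ i ⊎ x ≡ j) → count p ≡ 2
count≡2 p {i} {j} i≢j pi pj only = begin
  count p                                       ≡⟨ count-cong (λ x → T-ext (into x) (back x)) ⟩
  count (λ x → ⌊ x ≟ i ⌋ ∨ ⌊ x ≟ j ⌋)           ≡⟨ count-∨ (λ x → ⌊ x ≟ i ⌋) (λ x → ⌊ x ≟ j ⌋) disjoint ⟩
  count (λ x → ⌊ x ≟ i ⌋) + count (λ x → ⌊ x ≟ j ⌋) ≡⟨ cong₂ _+_ (count-≟ i) (count-≟ j) ⟩
  2                                             ∎
  where
  open ≡-Reasoning
  disjoint : ∀ x → T ⌊ x ≟ i ⌋ → ¬ T ⌊ x ≟ j ⌋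
  disjoint x x≡i x≡j = i≢j (trans (sym (toWitness x≡i)) (toWitness x≡j))
  into : ∀ x → T (p x) → T (⌊ x ≟ i ⌋ ∨ ⌊ x ≟ j ⌋)
  into x px = from (T-∨ {⌊ x ≟ i ⌋}) (Sum.map fromWitness fromWitness (only x px))
  back : ∀ x → T (⌊ x ≟ i ⌋ ∨ ⌊ x ≟ j ⌋) → T (p x)
  back x x∈ with to (T-∨ {⌊ x ≟ i ⌋}) x∈
  ... | inj₁ x≡i = subst (T ∘ p) (sym (toWitness x≡i)) pi
  ... | inj₂ x≡j = subst (T ∘ p) (sym (toWitness x≡j)) pj

count≡2⇒distinct : ∀ {k} (p : Fin k → Bool) → count p ≡ 2 → ∃[ i ] ∃[ j ] (i ≢ j × T (p i) × T (p j))
count≡2⇒distinct {suc k} p count≡2 with p zero in eq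
... | true  = let j , pj = count-suc⇒∃ (p ∘ suc) (cong pred count≡2)
              in zero , suc j , (λ ()) , subst T (sym eq) _ , pj
... | false = let i , j , i≢j , pi , pj = count≡2⇒distinct (p ∘ suc) count≡2
              in suc i , suc j , i≢j ∘ suc-injective , pi , pj

count≡2⇒other : ∀ {k} (p : Fin k → Bool) → count p ≡ 2 → ∀ i → ∃[ j ] (j ≢ i × T (p j))
count≡2⇒other p count≡2 i with count≡2⇒distinct p count≡2
... | j , j′ , j≢j′ , pj , pj′ with j ≟ i
...   | yes refl = j′ , j≢j′ ∘ sym , pj′
...   | no  j≢i  = j , j≢i , pj

enum : ∀ {k} (p : Fin k → Bool) → Fin (count p) → Fin k
enum {suc k} p i with p zero
enum {suc k} p zero    | true  = zero
enum {suc k} p (suc i) | true  = suc (enum (p ∘ suc) i)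
enum {suc k} p i       | false = suc (enum (p ∘ suc) i)

enum-sound : ∀ {k} (p : Fin k → Bool) i → T (p (enum p i))
enum-sound {suc k} p i with p zero in eq
enum-sound {suc k} p zero    | true  = subst T (sym eq) _
enum-sound {suc k} p (suc i) | true  = enum-sound (p ∘ suc) i
enum-sound {suc k} p i       | false = enum-sound (p ∘ suc) i

enum-injective : ∀ {k} (p : Fin k → Bool) {i j} → enum p i ≡ enum p j → i ≡ j
enum-injective {suc k} p {i} {j} eq with p zero
enum-injective {suc k} p {zero}  {zero}  eq | true  = refl
enum-injective {suc k} p {suc i} {suc j} eq | true  = cong suc (enum-injective (p ∘ suc) (suc-injective eq))
enum-injective {suc k} p {i}     {j}     eq | false = enum-injective (p ∘ suc) (suc-injective eq)

enum-complete : ∀ {k} (p : Fin k → Bool) {x} → T (p x) → ∃[ i ] enum p i ≡ x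
enum-complete {suc k} p {x} px with p zero in eq
enum-complete {suc k} p {zero}  px | true  = zero , refl
enum-complete {suc k} p {suc x} px | true  = let i , eq′ = enum-complete (p ∘ suc) px in suc i , cong suc eq′
enum-complete {suc k} p {zero}  px | false = ⊥-elim (subst T eq px)
enum-complete {suc k} p {suc x} px | false = let i , eq′ = enum-complete (p ∘ suc) px in i , cong suc eq′

least : ∀ {k} (p : Fin k → Bool) {i} → T (p i) → ∃[ g ] (T (p g) × (∀ h → h < g → ¬ T (p h)))
least p {zero}  pi = zero , pi , λ h ()
least p {suc i} pi with p zero in eq
... | true  = zero , subst T (sym eq) _ , λ h ()
... | false = let g , pg , below = least (p ∘ suc) pi in suc g , pg , minimal below
  where
  minimal : ∀ {g} → (∀ h → h < g → ¬ T (p (suc h))) → ∀ h → h < suc g → ¬ T (p h)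
  minimal below zero    _         p0 = subst T eq p0
  minimal below (suc h) (s≤s h<g) ph = below h h<g ph

module GraphTheory (G : Graph) where

  infixr 6 _∪_

  _∪_ : EdgeSet G → EdgeSet G → EdgeSet G
  (A ∪ B) e = A e ∨ B e

  _⊆_ : EdgeSet G → EdgeSet G → Set
  A ⊆ B = ∀ e → T (A e) → T (B e)

  Disjoint : EdgeSet G → EdgeSet G → Set
  Disjoint A B = ∀ e → T (A e) → ¬ T (B e)

  T-incB : ∀ {v e} → T (incB G v e) ⇔ Inc G v e
  T-incB {v} {e} = mk⇔ (Sum.map toWitness toWitness ∘ to (T-∨ {⌊ v ≟ src G e ⌋}))
                       (from (T-∨ {⌊ v ≟ src G e ⌋}) ∘ Sum.map fromWitness fromWitness)

  T-deg : ∀ {S : EdgeSet G} {v e} → T (S e ∧ incB G v e) ⇔ (T (S e) × Inc G v e)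
  T-deg {S} {v} {e} = mk⇔ (λ x → let se , ve = to (T-∧ {S e}) x in se , to T-incB ve)
                          (λ (se , ve) → from (T-∧ {S e}) (se , from T-incB ve))

  deg-cong : ∀ {A B : EdgeSet G} → (∀ e → A e ≡ B e) → ∀ v → deg G A v ≡ deg G B v
  deg-cong A≗B v = count-cong (λ e → cong (_∧ incB G v e) (A≗B e))

  deg-∪ : ∀ {A B : EdgeSet G} → Disjoint A B → ∀ v → deg G (A ∪ B) v ≡ deg G A v + deg G B v
  deg-∪ {A} {B} disjoint v = trans
    (count-cong (λ e → ∧-distribʳ-∨ (incB G v e) (A e) (B e)))
    (count-∨ _ _ (λ e ae be → disjoint e (proj₁ (to (T-deg {A} {v}) ae)) (proj₁ (to (T-deg {B} {v}) be))))

  incB-count : ∀ e → count (λ v → incB G v e) ≡ 2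
  incB-count e = count≡2 _ (loopless G e) (from T-incB (inj₁ refl)) (from T-incB (inj₂ refl)) (λ v → to T-incB)

  handshake : ∀ S → ∑[ v < n G ] deg G S v ≡ 2 * count S
  handshake S = begin
    ∑[ v < n G ] deg G S v                                   ≡⟨ sum-cong-≗ (λ v → count≡∑ (λ e → S e ∧ incB G v e)) ⟩
    ∑[ v < n G ] ∑[ e < m G ] 𝟙 (S e ∧ incB G v e)           ≡⟨ ∑-comm (λ v e → 𝟙 (S e ∧ incB G v e)) ⟩
    ∑[ e < m G ] ∑[ v < n G ] 𝟙 (S e ∧ incB G v e)           ≡⟨ sum-cong-≗ endpoints ⟩
    ∑[ e < m G ] (𝟙 (S e) + 𝟙 (S e))                         ≡⟨ ∑-distrib-+ (𝟙 ∘ S) (𝟙 ∘ S) ⟩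
    ∑[ e < m G ] 𝟙 (S e) + ∑[ e < m G ] 𝟙 (S e)             ≡⟨ cong (λ c → c + c) (sym (count≡∑ S)) ⟩
    count S + count S                                        ≡⟨ cong (count S +_) (sym (+-identityʳ (count S))) ⟩
    2 * count S                                              ∎
    where
    open ≡-Reasoning
    𝟙 : Bool → ℕ
    𝟙 b = if b then 1 else 0
    endpoints : ∀ e → ∑[ v < n G ] 𝟙 (S e ∧ incB G v e) ≡ 𝟙 (S e) + 𝟙 (S e)
    endpoints e with S e
    ... | true  = trans (sym (count≡∑ (λ v → incB G v e))) (incB-count e)
    ... | false = sum-replicate-zero (n G)

  balanced⇒even : ∀ {A B : EdgeSet G} → Disjoint A B → (∀ v → deg G A v ≡ deg G B v) → 2 ∣ count (A ∪ B)
  balanced⇒even {A} {B} disjoint balanced = divides (count A) (begin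
    count (A ∪ B)          ≡⟨ count-∨ A B disjoint ⟩
    count A + count B      ≡⟨ cong (count A +_) (sym |A|≡|B|) ⟩
    count A + count A      ≡⟨ cong (count A +_) (sym (+-identityʳ (count A))) ⟩
    2 * count A            ≡⟨ *-comm 2 (count A) ⟩
    count A * 2            ∎)
    where
    open ≡-Reasoning
    |A|≡|B| : count A ≡ count B
    |A|≡|B| = *-cancelˡ-≡ _ _ 2 (trans (sym (handshake A)) (trans (sum-cong-≗ balanced) (handshake B)))

  twoRegular-other : ∀ {S : EdgeSet G} → TwoRegular G S → ∀ {v e} → T (S e) → Inc G v e →
                     ∃[ f ] (f ≢ e × T (S f) × Inc G v f)
  twoRegular-other {S} regular {v} {e} se ve with regular v
  ... | inj₁ deg≡0 = ⊥-elim (count≡0⇒¬T _ deg≡0 e (from (T-deg {S}) (se , ve)))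
  ... | inj₂ deg≡2 = let f , f≢e , f∈ = count≡2⇒other _ deg≡2 e in f , f≢e , to (T-deg {S}) f∈

  Step : Fin (m G) → Fin (n G) → Fin (n G) → Set
  Step e u w = (u ≡ src G e × w ≡ tgt G e) ⊎ (u ≡ tgt G e × w ≡ src G e)

  Step-sym : ∀ {e u w} → Step e u w → Step e w u
  Step-sym = Sum.swap ∘ Sum.map Product.swap Product.swap

  Step⇒Inc : ∀ {e u w} → Step e u w → Inc G u e × Inc G w e
  Step⇒Inc (inj₁ (u≡s , w≡t)) = inj₁ u≡s , inj₂ w≡t
  Step⇒Inc (inj₂ (u≡t , w≡s)) = inj₂ u≡t , inj₁ w≡s

  infixr 5 _++ʷ_

  _++ʷ_ : ∀ {S u v w} → Walk G S u v → Walk G S v w → Walk G S u w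
  here             ++ʷ q = q
  step e se st p   ++ʷ q = step e se st (p ++ʷ q)

  reverseʷ : ∀ {S u v} → Walk G S u v → Walk G S v u
  reverseʷ here             = here
  reverseʷ (step e se st p) = reverseʷ p ++ʷ step e se (Step-sym st) here

  module Reachability (S : EdgeSet G) (r : Fin (n G)) where

    Sound : (Fin (n G) → Bool) → Set
    Sound R = T (R r) × (∀ y → T (R y) → Walk G S r y)

    Closed : (Fin (n G) → Bool) → Set
    Closed R = ∀ e → T (S e) → R (src G e) ≡ R (tgt G e)

    private
      xor-split : ∀ a b → T (a xor b) → (T a × ¬ T b) ⊎ (T b × ¬ T a)
      xor-split true  false _ = inj₁ (_ , λ ())
      xor-split false true  _ = inj₂ (_ , λ ())

      ¬xor⇒≡ : ∀ a b → ¬ T (a xor b) → a ≡ b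
      ¬xor⇒≡ false false _ = refl
      ¬xor⇒≡ false true  ¬x = ⊥-elim (¬x _)
      ¬xor⇒≡ true  false ¬x = ⊥-elim (¬x _)
      ¬xor⇒≡ true  true  _ = refl

      leaving? : ∀ R → Closed R ⊎ ∃[ e ] ∃[ u ] ∃[ w ] (T (S e) × Step e u w × T (R u) × ¬ T (R w))
      leaving? R with any? (λ e → T? (S e ∧ (R (src G e) xor R (tgt G e))))
      ... | no ¬leaving = inj₁ λ e se → ¬xor⇒≡ _ _ (λ x → ¬leaving (e , from (T-∧ {S e}) (se , x)))
      ... | yes (e , leaving) with to (T-∧ {S e}) leaving
      ...   | se , x with xor-split (R (src G e)) (R (tgt G e)) x
      ...     | inj₁ (rs , ¬rt) = inj₂ (e , _ , _ , se , inj₁ (refl , refl) , rs , ¬rt)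
      ...     | inj₂ (rt , ¬rs) = inj₂ (e , _ , _ , se , inj₂ (refl , refl) , rt , ¬rs)

      add : (Fin (n G) → Bool) → Fin (n G) → Fin (n G) → Bool
      add R w y = R y ∨ ⌊ y ≟ w ⌋

      count-add : ∀ R {w} → ¬ T (R w) → count (add R w) ≡ suc (count R)
      count-add R {w} ¬rw = begin
        count (add R w)                       ≡⟨ count-∨ R (λ y → ⌊ y ≟ w ⌋) (λ y ry y≡w → ¬rw (subst (T ∘ R) (toWitness y≡w) ry)) ⟩
        count R + count (λ y → ⌊ y ≟ w ⌋)     ≡⟨ cong (count R +_) (count-≟ w) ⟩
        count R + 1                           ≡⟨ +-comm (count R) 1 ⟩
        suc (count R)                         ∎
        where open ≡-Reasoning

      Sound-add : ∀ {R e u w} → Sound R → T (S e) → Step e u w → T (R u) → Sound (add R w)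
      Sound-add {R} {e} {u} {w} (rr , walk) se st ru = from (T-∨ {R r}) (inj₁ rr) , walk′
        where
        walk′ : ∀ y → T (add R w y) → Walk G S r y
        walk′ y y∈ with to (T-∨ {R y}) y∈
        ... | inj₁ ry  = walk y ry
        ... | inj₂ y≡w = subst (Walk G S r) (sym (toWitness y≡w)) (walk u ru ++ʷ step e se st here)

      -- Every round adds a vertex, so by the size invariant the fuel cannot run out.
      saturate : ∀ fuel R → Sound R → fuel + count R ≡ suc (n G) → Σ (Fin (n G) → Bool) λ R′ → Sound R′ × Closed R′
      saturate fuel R sound size with leaving? R
      ... | inj₁ closed = R , sound , closed
      saturate zero       R sound size | inj₂ _ = ⊥-elim (1+n≰n (subst (_≤ n G) size (count≤ R)))
      saturate (suc fuel) R sound size | inj₂ (e , u , w , se , st , ru , ¬rw) =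
        saturate fuel (add R w) (Sound-add sound se st ru)
                 (trans (cong (fuel +_) (count-add R ¬rw)) (trans (+-suc fuel (count R)) size))

    opaque
      saturated : Σ (Fin (n G) → Bool) λ R → Sound R × Closed R
      saturated = saturate (n G) (λ y → ⌊ y ≟ r ⌋)
                           (fromWitness refl , λ y y≡r → subst (Walk G S r) (sym (toWitness y≡r)) here)
                           (trans (cong (n G +_) (count-≟ r)) (+-comm (n G) 1))

    reach : Fin (n G) → Bool
    reach = proj₁ saturated

    reach-root : T (reach r)
    reach-root = proj₁ (proj₁ (proj₂ saturated))

    reach-sound : ∀ y → T (reach y) → Walk G S r y
    reach-sound = proj₂ (proj₁ (proj₂ saturated))

    reach-closed : Closed reach
    reach-closed = proj₂ (proj₂ saturated)

    reach-step : ∀ {e u w} → T (S e) → Step e u w → reach u ≡ reach w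
    reach-step {e} se (inj₁ (refl , refl)) = reach-closed e se
    reach-step {e} se (inj₂ (refl , refl)) = sym (reach-closed e se)

    reach-walk : ∀ {u w} → Walk G S u w → reach u ≡ reach w
    reach-walk here             = refl
    reach-walk (step e se st p) = trans (reach-step se st) (reach-walk p)

    reach-complete : ∀ {y} → Walk G S r y → T (reach y)
    reach-complete p = subst T (reach-walk p) reach-root

    reach-inc : ∀ {e u} → T (S e) → Inc G u e → reach u ≡ reach (src G e)
    reach-inc se (inj₁ refl) = refl
    reach-inc {e} se (inj₂ refl) = sym (reach-closed e se)

  open Reachability public using (reach; reach-root; reach-sound; reach-walk; reach-complete; reach-inc)

  restrict : (Fin (n G) → Bool) → EdgeSet G → EdgeSet G
  restrict R A e = A e ∧ R (src G e)

  component : EdgeSet G → Fin (n G) → EdgeSet G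
  component S v = restrict (reach S v) S

  reach-≗ : ∀ {S v u} → T (reach S v u) → ∀ y → reach S v y ≡ reach S u y
  reach-≗ {S} {v} {u} vu y = T-ext
    (λ vy → reach-complete S u (reverseʷ (reach-sound S v u vu) ++ʷ reach-sound S v y vy))
    (λ uy → reach-complete S v (reach-sound S v u vu ++ʷ reach-sound S u y uy))

  component-⊆ : ∀ {S v} → component S v ⊆ S
  component-⊆ {S} e = proj₁ ∘ to (T-∧ {S e})

  component-self : ∀ {S e} → T (S e) → T (component S (src G e) e)
  component-self {S} {e} se = from (T-∧ {S e}) (se , reach-root S (src G e))

  component-∋ : ∀ {S v u f} → T (S f) → Inc G u f → T (reach S v u) → T (component S v f)
  component-∋ {S} {v} {u} {f} sf uf vu = from (T-∧ {S f}) (sf , subst T (reach-inc S v sf uf) vu)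

  component-≗ : ∀ {S v e} → T (component S v e) → ∀ f → component S v f ≡ component S (src G e) f
  component-≗ {S} {v} {e} e∈ f = cong (S f ∧_) (reach-≗ (proj₂ (to (T-∧ {S e}) e∈)) (src G f))

  component-walk : ∀ {S v u w} → InSub G (component S v) u → InSub G (component S v) w →
                   Walk G (component S v) u w
  component-walk {S} {v} {u} {w} (e , e∈ , ue) (f , f∈ , wf) =
    lift (reverseʷ (reach-sound S v u (reached e∈ ue)) ++ʷ reach-sound S v w (reached f∈ wf))
                   (reached e∈ ue)
    where
    reached : ∀ {e u} → T (component S v e) → Inc G u e → T (reach S v u)
    reached {e} e∈ ue = subst T (sym (reach-inc S v (component-⊆ e e∈) ue)) (proj₂ (to (T-∧ {S e}) e∈))
    lift : ∀ {x y} → Walk G S x y → T (reach S v x) → Walk G (component S v) x y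
    lift here _ = here
    lift (step e se st p) vx =
      step e (component-∋ se (proj₁ (Step⇒Inc st)) vx) st
           (lift p (subst T (reach-walk S v (step e se st here)) vx))

  deg-restrict : ∀ {S A} → A ⊆ S → ∀ v u →
                 deg G (restrict (reach S v) A) u ≡ (if reach S v u then deg G A u else 0)
  deg-restrict {S} {A} A⊆S v u with reach S v u in vu
  ... | true  = count-cong (λ e → T-ext (outof e) (into e))
    where
    outof : ∀ e → T (restrict (reach S v) A e ∧ incB G u e) → T (A e ∧ incB G u e)
    outof e x = let e∈ , ue = to (T-deg {restrict (reach S v) A} {u}) x
                in from (T-deg {A} {u}) (proj₁ (to (T-∧ {A e}) e∈) , ue)
    into : ∀ e → T (A e ∧ incB G u e) → T (restrict (reach S v) A e ∧ incB G u e)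
    into e x = let ae , ue = to (T-deg {A} {u}) x in
      from (T-deg {restrict (reach S v) A} {u})
           (from (T-∧ {A e}) (ae , subst T (trans (sym vu) (reach-inc S v (A⊆S e ae) ue)) _) , ue)
  ... | false = count≡0 _ outside
    where
    outside : ∀ e → ¬ T (restrict (reach S v) A e ∧ incB G u e)
    outside e x = let e∈ , ue = to (T-deg {restrict (reach S v) A} {u}) x
                      ae , vs = to (T-∧ {A e}) e∈
                  in subst T (trans (sym (reach-inc S v (A⊆S e ae) ue)) vu) vs

  component-twoRegular : ∀ {S} → TwoRegular G S → ∀ v → TwoRegular G (component S v)
  component-twoRegular {S} regular v u rewrite deg-restrict {S} (λ _ → id) v u with reach S v u
  ... | true  = regular u
  ... | false = inj₁ refl

  component-circuit : ∀ {S} → TwoRegular G S → ∀ {e} → T (S e) → Circuit G (component S (src G e))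
  component-circuit regular {e} se =
    (e , component-self se) , component-twoRegular regular (src G e) , λ u w → component-walk

  component-shared : ∀ {S v w e} → T (component S v e) → T (component S w e) →
                     ∀ f → component S v f ≡ component S w f
  component-shared ve we f = trans (component-≗ ve f) (sym (component-≗ we f))

  classUnion-id : ∀ {N} (C : Fin N → EdgeSet G) j e → classUnion G C id j e ≡ C j e
  classUnion-id C j e = T-ext
    (λ x → let i , y = to T-anyFin x ; i≡j , ci = to (T-∧ {⌊ i ≟ j ⌋}) y in subst (λ i → T (C i e)) (toWitness i≡j) ci)
    (λ cj → from T-anyFin (j , from (T-∧ {⌊ j ≟ j ⌋}) (fromWitness refl , cj)))

  twoRegular-cong : ∀ {A B : EdgeSet G} → (∀ e → A e ≡ B e) → TwoRegular G B → TwoRegular G A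
  twoRegular-cong A≗B regular v rewrite deg-cong A≗B v = regular v

  colourClass : ∀ {k} → (Fin (m G) → Fin k) → Fin k → EdgeSet G
  colourClass c a e = ⌊ c e ≟ a ⌋

  Present : ∀ {k} → (Fin (m G) → Fin k) → Fin k → Fin (n G) → Set
  Present c a v = ∃[ e ] (Inc G v e × c e ≡ a)

  deg-colourClass≤1 : ∀ {k c} → ProperColoring G k c → ∀ a v → deg G (colourClass c a) v ≤ 1
  deg-colourClass≤1 {c = c} proper a v = count≤1 _ unique
    where
    unique : ∀ e f → T (colourClass c a e ∧ incB G v e) → T (colourClass c a f ∧ incB G v f) → e ≡ f
    unique e f x y with e ≟ f
    ... | yes e≡f = e≡f
    ... | no  e≢f = let ce , ve = to (T-deg {colourClass c a} {v}) x
                        cf , vf = to (T-deg {colourClass c a} {v}) y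
                    in ⊥-elim (proper e f (e≢f , v , ve , vf) (trans (toWitness ce) (sym (toWitness cf))))

  deg-colourClass : ∀ {k c} → ProperColoring G k c → ∀ a v →
                    (deg G (colourClass c a) v ≡ 0 × ¬ Present c a v) ⊎ (deg G (colourClass c a) v ≡ 1 × Present c a v)
  deg-colourClass {c = c} proper a v with n≤1⇒n≡0∨n≡1 (deg-colourClass≤1 proper a v)
  ... | inj₁ deg≡0 = inj₁ (deg≡0 , λ (e , ve , ce≡a) →
                       count≡0⇒¬T _ deg≡0 e (from (T-deg {colourClass c a} {v}) (fromWitness ce≡a , ve)))
  ... | inj₂ deg≡1 = inj₂ (deg≡1 , let e , x = count-suc⇒∃ _ deg≡1 ; ce , ve = to (T-deg {colourClass c a} {v}) x
                                  in e , ve , toWitness ce)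

  deg-colourClass-≡ : ∀ {k c c′} → ProperColoring G k c → ProperColoring G k c′ → ∀ {a v} →
                      Present c a v ⇔ Present c′ a v → deg G (colourClass c a) v ≡ deg G (colourClass c′ a) v
  deg-colourClass-≡ proper proper′ {a} {v} samePalette
    with deg-colourClass proper a v | deg-colourClass proper′ a v
  ... | inj₁ (d≡0 , _)  | inj₁ (d′≡0 , _)  = trans d≡0 (sym d′≡0)
  ... | inj₂ (d≡1 , _)  | inj₂ (d′≡1 , _)  = trans d≡1 (sym d′≡1)
  ... | inj₁ (_ , ¬p)   | inj₂ (_ , p′)    = ⊥-elim (¬p (from samePalette p′))
  ... | inj₂ (_ , p)    | inj₁ (_ , ¬p′)   = ⊥-elim (¬p′ (to samePalette p))

module CoverFromColouring (G : Graph) {l} {c₁ c₂ : Fin (m G) → Fin l}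
  (proper₁ : ProperColoring G l c₁) (proper₂ : ProperColoring G l c₂)
  (samePalette : ∀ v a → GraphTheory.Present G c₁ a v ⇔ GraphTheory.Present G c₂ a v) (differ : ∀ e → c₁ e ≢ c₂ e) where
  open GraphTheory G

  factor : Fin l → EdgeSet G
  factor a = colourClass c₁ a ∪ colourClass c₂ a

  T-factor : ∀ {a e} → T (factor a e) ⇔ (c₁ e ≡ a ⊎ c₂ e ≡ a)
  T-factor {a} {e} = mk⇔ (Sum.map toWitness toWitness ∘ to (T-∨ {colourClass c₁ a e}))
                         (from (T-∨ {colourClass c₁ a e}) ∘ Sum.map fromWitness fromWitness)

  c₁∈factor : ∀ e → T (factor (c₁ e) e)
  c₁∈factor e = from T-factor (inj₁ refl)

  c₂∈factor : ∀ e → T (factor (c₂ e) e)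
  c₂∈factor e = from T-factor (inj₂ refl)

  classes-disjoint : ∀ a → Disjoint (colourClass c₁ a) (colourClass c₂ a)
  classes-disjoint a e c₁e c₂e = differ e (trans (toWitness c₁e) (sym (toWitness c₂e)))

  classes-balanced : ∀ a v → deg G (colourClass c₁ a) v ≡ deg G (colourClass c₂ a) v
  classes-balanced a v = deg-colourClass-≡ proper₁ proper₂ (samePalette v a)

  factor-twoRegular : ∀ a → TwoRegular G (factor a)
  factor-twoRegular a v rewrite deg-∪ (classes-disjoint a) v | sym (classes-balanced a v)
    with deg G (colourClass c₁ a) v | deg-colourClass≤1 proper₁ a v
  ... | 0           | _         = inj₁ refl
  ... | 1           | _         = inj₂ refl
  ... | suc (suc _) | s≤s ()

  component-even : ∀ a v → 2 ∣ count (component (factor a) v)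
  component-even a v = subst (2 ∣_) (count-cong (λ e → sym (∧-distribʳ-∨ (R (src G e)) (c₁ᵃ e) (c₂ᵃ e))))
                             (balanced⇒even disjoint balanced)
    where
    R = reach (factor a) v
    c₁ᵃ = colourClass c₁ a
    c₂ᵃ = colourClass c₂ a
    disjoint : Disjoint (restrict R c₁ᵃ) (restrict R c₂ᵃ)
    disjoint e x y = classes-disjoint a e (proj₁ (to (T-∧ {c₁ᵃ e}) x)) (proj₁ (to (T-∧ {c₂ᵃ e}) y))
    balanced : ∀ u → deg G (restrict R c₁ᵃ) u ≡ deg G (restrict R c₂ᵃ) u
    balanced u = begin
      deg G (restrict R c₁ᵃ) u                  ≡⟨ deg-restrict (λ e → from (T-∨ {c₁ᵃ e}) ∘ inj₁) v u ⟩
      (if R u then deg G c₁ᵃ u else 0)          ≡⟨ cong (if R u then_else 0) (classes-balanced a u) ⟩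
      (if R u then deg G c₂ᵃ u else 0)          ≡⟨ sym (deg-restrict (λ e → from (T-∨ {c₁ᵃ e}) ∘ inj₂) v u) ⟩
      deg G (restrict R c₂ᵃ) u                  ∎
      where open ≡-Reasoning

  circuit : Fin (m G) → EdgeSet G
  circuit x = component (factor (c₁ x)) (src G x)

  circuit-self : ∀ x → T (circuit x x)
  circuit-self x = component-self (c₁∈factor x)

  circuit-as-component : ∀ {a v x} → c₁ x ≡ a → T (component (factor a) v x) →
                         ∀ f → circuit x f ≡ component (factor a) v f
  circuit-as-component {x = x} c₁x≡a x∈ f =
    trans (cong (λ b → component (factor b) (src G x) f) c₁x≡a) (sym (component-≗ x∈ f))

  circuits-agree : ∀ {x y e} → c₁ x ≡ c₁ y → T (circuit x e) → T (circuit y e) → ∀ f → circuit x f ≡ circuit y f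
  circuits-agree {x} {y} {e} same xe ye f =
    trans (cong (λ a → component (factor a) (src G x) f) same)
          (component-shared (subst (λ a → T (component (factor a) (src G x) e)) same xe) ye f)

  -- A circuit is indexed by its least edge among those to which c₁ gives the circuit's colour.
  Leader : Fin (m G) → Set
  Leader x = ∀ g → g < x → c₁ g ≡ c₁ x → ¬ T (circuit x g)

  isLeader : Fin (m G) → Bool
  isLeader x = ⌊ all? (λ g → (g <? x) →-dec ((c₁ g ≟ c₁ x) →-dec ¬? (T? (circuit x g)))) ⌋

  leader-unique : ∀ {x y e} → Leader x → Leader y → c₁ x ≡ c₁ y → T (circuit x e) → T (circuit y e) → x ≡ y
  leader-unique {x} {y} lx ly same xe ye with <-cmp x y
  ... | tri< x<y _ _ = ⊥-elim (ly x x<y same (subst T (circuits-agree same xe ye x) (circuit-self x)))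
  ... | tri≈ _ x≡y _ = x≡y
  ... | tri> _ _ y<x = ⊥-elim (lx y y<x (sym same) (subst T (circuits-agree (sym same) ye xe y) (circuit-self y)))

  coloured-edge : ∀ {a e} → T (factor a e) → ∃[ f ] (c₁ f ≡ a × T (component (factor a) (src G e) f))
  coloured-edge {a} {e} ae with to T-factor ae
  ... | inj₁ c₁e≡a = e , c₁e≡a , component-self ae
  ... | inj₂ c₂e≡a =
    let f , ef , c₁f≡a = from (samePalette (src G e) a) (e , inj₁ refl , c₂e≡a)
    in f , c₁f≡a , component-∋ (from T-factor (inj₁ c₁f≡a)) ef (reach-root (factor a) (src G e))

  least-coloured-edge : ∀ {a v f} → c₁ f ≡ a → T (component (factor a) v f) →
    ∃[ g ] (c₁ g ≡ a × T (component (factor a) v g) × (∀ h → h < g → c₁ h ≡ a → ¬ T (component (factor a) v h)))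
  least-coloured-edge {a} {v} {f} c₁f≡a f∈
    with least (λ h → ⌊ c₁ h ≟ a ⌋ ∧ component (factor a) v h) (from (T-∧ {⌊ c₁ f ≟ a ⌋}) (fromWitness c₁f≡a , f∈))
  ... | g , pg , below = let c₁g≡a , g∈ = to (T-∧ {⌊ c₁ g ≟ a ⌋}) pg in
    g , toWitness c₁g≡a , g∈ , λ h h<g c₁h≡a h∈ → below h h<g (from (T-∧ {⌊ c₁ h ≟ a ⌋}) (fromWitness c₁h≡a , h∈))

  leader-exists : ∀ {a e} → T (factor a e) → ∃[ x ] (Leader x × c₁ x ≡ a × T (circuit x e))
  leader-exists {a} {e} ae =
    let f , c₁f≡a , f∈ = coloured-edge ae
        g , c₁g≡a , g∈ , below = least-coloured-edge c₁f≡a f∈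
        agree = circuit-as-component c₁g≡a g∈
    in g , (λ h h<g c₁h≡c₁g h∈ → below h h<g (trans c₁h≡c₁g c₁g≡a) (subst T (agree h) h∈))
         , c₁g≡a , subst T (sym (agree e)) (component-self ae)

  N : ℕ
  N = count isLeader

  leaders : Fin N → Fin (m G)
  leaders = enum isLeader

  cover : Fin N → EdgeSet G
  cover = circuit ∘ leaders

  colour : Fin N → Fin l
  colour = c₁ ∘ leaders

  cover-unique : ∀ {i j e} → colour i ≡ colour j → T (cover i e) → T (cover j e) → i ≡ j
  cover-unique {i} {j} same ie je = enum-injective isLeader
    (leader-unique (toWitness (enum-sound isLeader i)) (toWitness (enum-sound isLeader j)) same ie je)

  cover-exists : ∀ {a e} → T (factor a e) → ∃[ i ] (colour i ≡ a × T (cover i e))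
  cover-exists ae with leader-exists ae
  ... | x , leader , c₁x≡a , xe with enum-complete isLeader (fromWitness leader)
  ...   | i , refl = i , c₁x≡a , xe

  cover-double : ∀ e → count (λ i → cover i e) ≡ 2
  cover-double e =
    let i₁ , colour₁ , e∈₁ = cover-exists (c₁∈factor e)
        i₂ , colour₂ , e∈₂ = cover-exists (c₂∈factor e)
        only : ∀ i → T (cover i e) → i ≡ i₁ ⊎ i ≡ i₂
        only i e∈ = Sum.map (λ c₁e≡ → cover-unique (trans (sym c₁e≡) (sym colour₁)) e∈ e∈₁)
                            (λ c₂e≡ → cover-unique (trans (sym c₂e≡) (sym colour₂)) e∈ e∈₂)
                            (to T-factor (component-⊆ e e∈))
    in count≡2 _ (λ i₁≡i₂ → differ e (trans (sym colour₁) (trans (cong colour i₁≡i₂) colour₂))) e∈₁ e∈₂ only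

  cover-circuits : ∀ i → Circuit G (cover i)
  cover-circuits i = component-circuit (factor-twoRegular (colour i)) (c₁∈factor (leaders i))

  cover-even : AllEven G cover
  cover-even i = component-even (colour i) (src G (leaders i))

  circuitIndex : Fin (m G) → Fin N
  circuitIndex e = proj₁ (cover-exists (c₁∈factor e))

  circuitIndex-proper : ProperColoring G N circuitIndex
  circuitIndex-proper e f adj same = proper₁ e f adj (begin
    c₁ e                      ≡⟨ sym (proj₁ (proj₂ (cover-exists (c₁∈factor e)))) ⟩
    colour (circuitIndex e)   ≡⟨ cong colour same ⟩
    colour (circuitIndex f)   ≡⟨ proj₁ (proj₂ (cover-exists (c₁∈factor f))) ⟩
    c₁ f                      ∎)
    where open ≡-Reasoning

  cover-partition : GoodPartition G cover
  cover-partition = N , id , (λ k χ′ → proj₂ χ′ N (circuitIndex , circuitIndex-proper)) , (λ j → j , refl)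
                  , λ j → twoRegular-cong (classUnion-id cover j) (proj₁ (proj₂ (cover-circuits j)))

  factor-c₂ : ∀ {a e} → T (factor a e) → c₁ e ≢ a → c₂ e ≡ a
  factor-c₂ ae c₁e≢a = Sum.[ ⊥-elim ∘ c₁e≢a , id ] (to T-factor ae)

  same-side : ∀ {a b e f} → T (factor a e) → T (factor b f) → ⌊ c₁ e ≟ a ⌋ ≡ ⌊ c₁ f ≟ b ⌋ →
              (c₁ e ≡ a × c₁ f ≡ b) ⊎ (c₂ e ≡ a × c₂ f ≡ b)
  same-side {a} {b} {e} {f} ae bf = decide (c₁ e ≟ a) (c₁ f ≟ b)
    where
    decide : (d : Dec (c₁ e ≡ a)) (d′ : Dec (c₁ f ≡ b)) → ⌊ d ⌋ ≡ ⌊ d′ ⌋ →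
             (c₁ e ≡ a × c₁ f ≡ b) ⊎ (c₂ e ≡ a × c₂ f ≡ b)
    decide (yes c₁e≡a) (yes c₁f≡b) _ = inj₁ (c₁e≡a , c₁f≡b)
    decide (no c₁e≢a)  (no c₁f≢b)  _ = inj₂ (factor-c₂ ae c₁e≢a , factor-c₂ bf c₁f≢b)
    decide (yes _)     (no _)      ()
    decide (no _)      (yes _)     ()

  side : Fin N → Fin (m G) → Fin 2
  side i e = bit ⌊ c₁ e ≟ colour i ⌋

  cover-twoColouring : GoodTwoColoring G cover
  cover-twoColouring = side , side-proper , side-distinct
    where
    side-proper : ∀ i e f → T (cover i e) → T (cover i f) → Adjacent G e f → side i e ≢ side i f
    side-proper i e f e∈ f∈ adj same with same-side (component-⊆ e e∈) (component-⊆ f f∈) (bit-injective same)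
    ... | inj₁ (c₁e , c₁f) = proper₁ e f adj (trans c₁e (sym c₁f))
    ... | inj₂ (c₂e , c₂f) = proper₂ e f adj (trans c₂e (sym c₂f))
    side-distinct : ∀ i j e → i ≢ j → T (cover i e) → T (cover j e) → side i e ≢ side j e
    side-distinct i j e i≢j e∈ e∈′ same with same-side (component-⊆ e e∈) (component-⊆ e e∈′) (bit-injective same)
    ... | inj₁ (c₁e , c₁e′) = i≢j (cover-unique (trans (sym c₁e) c₁e′) e∈ e∈′)
    ... | inj₂ (c₂e , c₂e′) = i≢j (cover-unique (trans (sym c₂e) c₂e′) e∈ e∈′)

module ColouringFromCover (G : Graph) {N} {C : Fin N → EdgeSet G} (cdc : IsCDC G N C)
  (side : Fin N → Fin (m G) → Fin 2)
  (side-proper : ∀ i e f → T (C i e) → T (C i f) → Adjacent G e f → side i e ≢ side i f)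
  (side-distinct : ∀ i j e → i ≢ j → T (C i e) → T (C j e) → side i e ≢ side j e) where
  open GraphTheory G

  side-unique : ∀ {i j e} → T (C i e) → T (C j e) → side i e ≡ side j e → i ≡ j
  side-unique {i} {j} {e} ie je same with i ≟ j
  ... | yes i≡j = i≡j
  ... | no  i≢j = ⊥-elim (side-distinct i j e i≢j ie je same)

  circuitOnSide : ∀ e b → ∃[ i ] (T (C i e) × side i e ≡ b)
  circuitOnSide e b with count≡2⇒distinct _ (proj₂ cdc e)
  ... | i , j , i≢j , ie , je with Fin2-covered (side-distinct i j e i≢j ie je) b
  ...   | inj₁ b≡ = i , ie , sym b≡
  ...   | inj₂ b≡ = j , je , sym b≡

  colouring : Fin 2 → Fin (m G) → Fin N
  colouring b e = proj₁ (circuitOnSide e b)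

  colouring-∈ : ∀ b e → T (C (colouring b e) e)
  colouring-∈ b e = proj₁ (proj₂ (circuitOnSide e b))

  colouring-side : ∀ b e → side (colouring b e) e ≡ b
  colouring-side b e = proj₂ (proj₂ (circuitOnSide e b))

  colouring-proper : ∀ b → ProperColoring G N (colouring b)
  colouring-proper b e f adj same =
    side-proper (colouring b e) e f (colouring-∈ b e) (subst (λ i → T (C i f)) (sym same) (colouring-∈ b f)) adj
                (trans (colouring-side b e) (sym (subst (λ i → side i f ≡ b) (sym same) (colouring-side b f))))

  colourings-differ : ∀ e → colouring zero e ≢ colouring (suc zero) e
  colourings-differ e same with trans (sym (colouring-side zero e))
                                 (trans (cong (λ i → side i e) same) (colouring-side (suc zero) e))
  ... | ()

  -- The other edge of circuit a at v has the other side, so the other colouring sends it to a.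
  palette-swap : ∀ {b b′ v a} → b ≢ b′ → Present (colouring b) a v → Present (colouring b′) a v
  palette-swap {b} {b′} {v} {a} b≢b′ (e , ve , e↦a) with subst (λ i → T (C i e)) e↦a (colouring-∈ b e)
  ... | ae with twoRegular-other (proj₁ (proj₂ (proj₁ cdc a))) ae ve
  ...   | f , f≢e , af , vf with Fin2-covered b≢b′ (side a f)
  ...     | inj₁ af↦b  = ⊥-elim (side-proper a f e af ae (f≢e , v , vf , ve)
                                   (trans af↦b (sym (subst (λ i → side i e ≡ b) e↦a (colouring-side b e)))))
  ...     | inj₂ af↦b′ = f , vf , sym (side-unique af (colouring-∈ b′ f) (trans af↦b′ (sym (colouring-side b′ f))))

  simultaneous : TwoSimultaneousColorable G
  simultaneous = N , colouring zero , colouring (suc zero) , colouring-proper zero , colouring-proper (suc zero)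
               , (λ v a → mk⇔ (palette-swap (λ ())) (palette-swap (λ ()))) , colourings-differ

colouring⇒cover : ∀ G → TwoSimultaneousColorable G →
  ∃[ N ] ∃[ C ] (IsCDC G N C × AllEven G C × GoodPartition G C × GoodTwoColoring G C)
colouring⇒cover G (l , c₁ , c₂ , proper₁ , proper₂ , samePalette , differ) =
  N , cover , (cover-circuits , cover-double) , cover-even , cover-partition , cover-twoColouring
  where open CoverFromColouring G proper₁ proper₂ samePalette differ

cover⇒colouring : ∀ G → ∃[ N ] ∃[ C ] (IsCDC G N C × AllEven G C × GoodPartition G C × GoodTwoColoring G C) →
  TwoSimultaneousColorable G
cover⇒colouring G (N , C , cdc , _ , _ , side , side-proper , side-distinct) =
  ColouringFromCover.simultaneous G cdc side side-proper side-distinct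

theorem3p4 : (G : Graph) → Bridgeless G →
    (TwoSimultaneousColorable G ⇔
      (∃[ N ] ∃[ C ] (IsCDC G N C × AllEven G C × GoodPartition G C × GoodTwoColoring G C)))
theorem3p4 G _ = mk⇔ (colouring⇒cover G) (cover⇒colouring G)
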